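{- There exist groups $G$ having more than one GI-extension up to isomorphism (i.e. two GI-extensions $G'_1,G'_2$ of $G$ with $G'_1\not\cong G'_2$).
   Context: Definition: given a group $G'$ and a normal subgroup $G\trianglelefteq G'$ of index $2$, $G'$ is called a GI-extension of $G$ if $G'$ is generated by involutions (elements of order $2$) that are not contained in $G$. -}

module Defs where

open import Level using (Level; _⊔_)
open import Algebra.Bundles using (Group)
open import Algebra.Morphism.Structures using (module GroupMorphisms)
open import Data.Product using (Σ; ∃; _×_; _,_)
open import Data.Sum using (_⊎_)
open import Relation.Nullary using (¬_)

private
  variable
    c ℓ c₁ ℓ₁ c₂ ℓ₂ : Level

module _ (G : Group c ℓ) where
  open Group G

  data ⟨_⟩ (S : Carrier → Set (c ⊔ ℓ)) : Carrier → Set (c ⊔ ℓ) where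
    gen  : ∀ {x} → S x → ⟨ S ⟩ x
    unit : ⟨ S ⟩ ε
    mul  : ∀ {x y} → ⟨ S ⟩ x → ⟨ S ⟩ y → ⟨ S ⟩ (x ∙ y)
    inv  : ∀ {x} → ⟨ S ⟩ x → ⟨ S ⟩ (x ⁻¹)
    resp : ∀ {x y} → x ≈ y → ⟨ S ⟩ x → ⟨ S ⟩ y

  GeneratedBy : (Carrier → Set (c ⊔ ℓ)) → Set (c ⊔ ℓ)
  GeneratedBy S = ∀ x → ⟨ S ⟩ x

  IsInvolution : Carrier → Set ℓ
  IsInvolution x = (x ∙ x ≈ ε) × ¬ (x ≈ ε)

  IsNormalSubgroup : (Carrier → Set (c ⊔ ℓ)) → Set (c ⊔ ℓ)
  IsNormalSubgroup N =
    (∀ {x y} → x ≈ y → N x → N y) ×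
    N ε ×
    (∀ {x y} → N x → N y → N (x ∙ y)) ×
    (∀ {x} → N x → N (x ⁻¹)) ×
    (∀ g {n} → N n → N ((g ∙ n) ∙ g ⁻¹))

  HasIndex2 : (Carrier → Set (c ⊔ ℓ)) → Set (c ⊔ ℓ)
  HasIndex2 N = Σ Carrier λ a → ¬ N a × (∀ x → N x ⊎ N (a ⁻¹ ∙ x))

_≅_ : Group c₁ ℓ₁ → Group c₂ ℓ₂ → Set (c₁ ⊔ ℓ₁ ⊔ c₂ ⊔ ℓ₂)
G₁ ≅ G₂ = Σ (Group.Carrier G₁ → Group.Carrier G₂) λ f →
  GroupMorphisms.IsGroupIsomorphism (Group.rawGroup G₁) (Group.rawGroup G₂) f

IsGIExtension : (G : Group c ℓ) (G' : Group c ℓ) → Set (c ⊔ ℓ)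
IsGIExtension G G' =
  Σ (Group.Carrier G → Group.Carrier G') λ ι →
    GroupMorphisms.IsGroupMonomorphism (Group.rawGroup G) (Group.rawGroup G') ι ×
    (let open Group G'
         N : Carrier → Set _
         N y = ∃ λ x → ι x ≈ y
     in IsNormalSubgroup G' N × HasIndex2 G' N ×
        GeneratedBy G' (λ y → IsInvolution G' y × ¬ N y))

{-# OPTIONS --safe #-}

-- Let E ≤ S₃ × S₃ consist of the pairs of permutations of equal sign; it has index 2.
-- S₃ × S₃ is a GI-extension of E: for a reflection τ the pairs (τ, 1) and (1, τ) are
-- involutions outside E, and every permutation is a product of at most two reflections.
-- E × C₂ is one as well: E is generated by elements g with g² = 1, and each such g gives
-- an involution (g, 1) outside E × 0. The two are not isomorphic, since (1, 1) is central
-- in E × C₂ while S₃ × S₃ has trivial centre.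
module Submission where

open import Defs
open import Level using (Level; 0ℓ; _⊔_; Lift; lift)
open import Algebra.Bundles using (Group; RawGroup; CommutativeRing)
open import Algebra.Construct.DirectProduct using () renaming (group to _×ᴳ_)
open import Algebra.Morphism.Structures using (module GroupMorphisms)
import Algebra.Morphism.GroupMonomorphism as GroupMonomorphism
open import Data.Bool using (Bool; true; false; not; _xor_)
open import Data.Bool.Properties
  using (xor-∧-commutativeRing; xor-comm; xor-assoc; xor-same; xor-identityʳ; ¬-not)
  renaming (_≟_ to _≟ᵇ_)
open import Data.Fin using (Fin; zero; suc; _≟_)
open import Data.Fin.Properties using (all?; any?)
open import Data.Product using (Σ; ∃; ∃₂; _×_; _,_; proj₁; proj₂)
open import Data.Product.Relation.Binary.Pointwise.NonDependent using (Pointwise)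
open import Data.Sum using (_⊎_; inj₁; inj₂)
open import Data.Empty using (⊥-elim)
open import Function using (_on_)
open import Relation.Nullary using (¬_; Dec; yes; no)
open import Relation.Nullary.Decidable using (from-yes; _×-dec_; _⊎-dec_; _→-dec_)
open import Relation.Binary.PropositionalEquality as ≡ using (_≡_; _≢_; refl)
import Relation.Binary.Reasoning.Setoid as SetoidReasoning

open GroupMorphisms using (IsGroupHomomorphism; IsGroupMonomorphism; IsGroupIsomorphism)

private
  variable
    c ℓ c₁ ℓ₁ c₂ ℓ₂ : Level

C₂ : Group 0ℓ 0ℓ
C₂ = CommutativeRing.+-group xor-∧-commutativeRing

module _ (G : Group c ℓ) where
  open Group G

  IsCentral : Carrier → Set (c ⊔ ℓ)
  IsCentral z = ∀ y → z ∙ y ≈ y ∙ z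

  HasTrivialCentre : Set (c ⊔ ℓ)
  HasTrivialCentre = ∀ z → IsCentral z → z ≈ ε

  SquaresToOne : Carrier → Set (c ⊔ ℓ)
  SquaresToOne x = Lift c (x ∙ x ≈ ε)

≅⇒trivialCentre : (G : Group c₁ ℓ₁) (H : Group c₂ ℓ₂) →
                  G ≅ H → HasTrivialCentre H → HasTrivialCentre G
≅⇒trivialCentre G H (f , iso) trivial z z-central =
  injective (H.trans (trivial (f z) fz-central) (H.sym ε-homo))
  where
  module G = Group G
  module H = Group H
  open IsGroupIsomorphism iso
  open SetoidReasoning H.setoid

  fz-central : IsCentral H (f z)
  fz-central y with surjective y
  ... | x , fx≈y = begin
    f z ∙ y      ≈⟨ H.∙-congˡ (fx≈y G.refl) ⟨
    f z ∙ f x    ≈⟨ ∙-homo z x ⟨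
    f (z G.∙ x)  ≈⟨ ⟦⟧-cong (z-central x) ⟩
    f (x G.∙ z)  ≈⟨ ∙-homo x z ⟩
    f x ∙ f z    ≈⟨ H.∙-congʳ (fx≈y G.refl) ⟩
    y ∙ f z      ∎
    where open Group H using (_∙_)

×-trivialCentre : (A : Group c₁ ℓ₁) (B : Group c₂ ℓ₂) →
                  HasTrivialCentre A → HasTrivialCentre B → HasTrivialCentre (A ×ᴳ B)
×-trivialCentre A B trivialA trivialB (a , b) central =
  trivialA a (λ x → proj₁ (central (x , Group.ε B))) ,
  trivialB b (λ y → proj₂ (central (Group.ε A , y)))

module _ (G : Group c ℓ) where
  open Group G renaming (refl to ≈-refl; sym to ≈-sym; trans to ≈-trans)

  ×C₂-nontrivialCentre : ¬ HasTrivialCentre (G ×ᴳ C₂)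
  ×C₂-nontrivialCentre trivial with trivial (ε , true) central
    where
    central : IsCentral (G ×ᴳ C₂) (ε , true)
    central (x , b) = ≈-trans (identityˡ x) (≈-sym (identityʳ x)) , xor-comm true b
  ... | _ , ()

  ×C₂≇centreless : (H : Group c₂ ℓ₂) → HasTrivialCentre H → ¬ ((G ×ᴳ C₂) ≅ H)
  ×C₂≇centreless H trivial iso = ×C₂-nontrivialCentre (≅⇒trivialCentre (G ×ᴳ C₂) H iso trivial)

  ×C₂-isGIExtension : GeneratedBy G (SquaresToOne G) → IsGIExtension G (G ×ᴳ C₂)
  ×C₂-isGIExtension generated = ι , ι-isMonomorphism , normal , index2 , generated′
    where
    ι : Carrier → Carrier × Bool
    ι x = x , false

    ι-isMonomorphism : IsGroupMonomorphism (Group.rawGroup G) (Group.rawGroup (G ×ᴳ C₂)) ι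
    ι-isMonomorphism = record
      { isGroupHomomorphism = record
        { isMonoidHomomorphism = record
          { isMagmaHomomorphism = record
            { isRelHomomorphism = record { cong = λ x≈y → x≈y , refl }
            ; homo = λ _ _ → ≈-refl , refl }
          ; ε-homo = ≈-refl , refl }
        ; ⁻¹-homo = λ _ → ≈-refl , refl }
      ; injective = proj₁ }

    N : Carrier × Bool → Set (c ⊔ ℓ)
    N y = ∃ λ x → Pointwise _≈_ _≡_ (ι x) y

    normal : IsNormalSubgroup (G ×ᴳ C₂) N
    normal =
      (λ { (y≈y′ , refl) (x , x≈y , refl) → x , ≈-trans x≈y y≈y′ , refl }) ,
      (ε , ≈-refl , refl) ,
      (λ { (x , x≈ , refl) (y , y≈ , refl) → x ∙ y , ∙-cong x≈ y≈ , refl }) ,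
      (λ { (x , x≈ , refl) → x ⁻¹ , ⁻¹-cong x≈ , refl }) ,
      λ { (g , b) (x , x≈ , refl) → (g ∙ x) ∙ g ⁻¹ , ∙-congʳ (∙-congˡ x≈) , conjugate-parity b }
      where
      conjugate-parity : ∀ b → false ≡ (b xor false) xor b
      conjugate-parity false = refl
      conjugate-parity true  = refl

    index2 : HasIndex2 (G ×ᴳ C₂) N
    index2 = (ε , true) , (λ { (_ , _ , ()) }) ,
      λ { (x , false) → inj₁ (x , ≈-refl , refl)
        ; (x , true)  → inj₂ (ε ⁻¹ ∙ x , ≈-refl , refl) }

    Generator : Carrier × Bool → Set (c ⊔ ℓ)
    Generator y = IsInvolution (G ×ᴳ C₂) y × ¬ N y

    odd : ∀ {x} → x ∙ x ≈ ε → Generator (x , true)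
    odd x²≈ε = ((x²≈ε , refl) , λ { (_ , ()) }) , λ { (_ , _ , ()) }

    even : ∀ {x} → ⟨ G ⟩ (SquaresToOne G) x → ⟨ G ×ᴳ C₂ ⟩ Generator (x , false)
    even (gen (lift x²≈ε)) = resp (identityʳ _ , refl) (mul (gen (odd x²≈ε)) (gen (odd (identityˡ ε))))
    even unit              = unit
    even (mul p q)         = mul (even p) (even q)
    even (inv p)           = inv (even p)
    even (resp x≈y p)      = resp (x≈y , refl) (even p)

    generated′ : GeneratedBy (G ×ᴳ C₂) Generator
    generated′ (x , false) = even (generated x)
    generated′ (x , true)  = resp (identityʳ x , refl) (mul (even (generated x)) (gen (odd (identityˡ ε))))

module FibreProduct (K : Group c ℓ) {σ : Group.Carrier K → Bool}
  (σ-isHomomorphism : IsGroupHomomorphism (Group.rawGroup K) (Group.rawGroup C₂) σ) where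
  open Group K renaming (refl to ≈-refl; sym to ≈-sym; trans to ≈-trans)
  open IsGroupHomomorphism σ-isHomomorphism using ()
    renaming (⟦⟧-cong to σ-cong; homo to σ-∙; ε-homo to σ-ε; ⁻¹-homo to σ-⁻¹)

  SameSign : Carrier × Carrier → Set
  SameSign (x , y) = σ x ≡ σ y

  fibreProduct-rawGroup : RawGroup c ℓ
  fibreProduct-rawGroup = record
    { Carrier = Σ (Carrier × Carrier) SameSign
    ; _≈_     = Pointwise _≈_ _≈_ on proj₁
    ; _∙_     = λ ((x , y) , s) ((x′ , y′) , s′) →
                  (x ∙ x′ , y ∙ y′) ,
                  ≡.trans (σ-∙ x x′) (≡.trans (≡.cong₂ _xor_ s s′) (≡.sym (σ-∙ y y′)))
    ; ε       = (ε , ε) , ≡.trans σ-ε (≡.sym σ-ε)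
    ; _⁻¹     = λ ((x , y) , s) →
                  (x ⁻¹ , y ⁻¹) , ≡.trans (σ-⁻¹ x) (≡.trans s (≡.sym (σ-⁻¹ y)))
    }

  proj₁-isMonomorphism : IsGroupMonomorphism fibreProduct-rawGroup (Group.rawGroup (K ×ᴳ K)) proj₁
  proj₁-isMonomorphism = record
    { isGroupHomomorphism = record
      { isMonoidHomomorphism = record
        { isMagmaHomomorphism = record
          { isRelHomomorphism = record { cong = λ x≈y → x≈y }
          ; homo = λ _ _ → ≈-refl , ≈-refl }
        ; ε-homo = ≈-refl , ≈-refl }
      ; ⁻¹-homo = λ _ → ≈-refl , ≈-refl }
    ; injective = λ x≈y → x≈y }

  fibreProduct : Group c ℓ
  fibreProduct = record
    { RawGroup fibreProduct-rawGroup
    ; isGroup = GroupMonomorphism.isGroup proj₁-isMonomorphism (Group.isGroup (K ×ᴳ K))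
    }

  σ-conjugate : ∀ g x → σ ((g ∙ x) ∙ g ⁻¹) ≡ σ x
  σ-conjugate g x = begin
    σ ((g ∙ x) ∙ g ⁻¹)       ≡⟨ σ-∙ (g ∙ x) (g ⁻¹) ⟩
    σ (g ∙ x) xor σ (g ⁻¹)   ≡⟨ ≡.cong₂ _xor_ (σ-∙ g x) (σ-⁻¹ g) ⟩
    (σ g xor σ x) xor σ g    ≡⟨ ≡.cong (_xor σ g) (xor-comm (σ g) (σ x)) ⟩
    (σ x xor σ g) xor σ g    ≡⟨ xor-assoc (σ x) (σ g) (σ g) ⟩
    σ x xor (σ g xor σ g)    ≡⟨ ≡.cong (σ x xor_) (xor-same (σ g)) ⟩
    σ x xor false            ≡⟨ xor-identityʳ (σ x) ⟩
    σ x                      ∎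
    where open ≡.≡-Reasoning

  IsReflection : Carrier → Set ℓ
  IsReflection r = r ∙ r ≈ ε × σ r ≡ true

  IsRotation : Carrier → Set (c ⊔ ℓ)
  IsRotation x = ∃₂ λ r s → IsReflection r × IsReflection s × x ≈ r ∙ s

  reflection-odd : ∀ {r} → IsReflection r → σ r ≢ σ ε
  reflection-odd (_ , σr≡true) σr≡σε with ≡.trans (≡.sym σr≡true) (≡.trans σr≡σε σ-ε)
  ... | ()

  reflection≉ε : ∀ {r} → IsReflection r → ¬ r ≈ ε
  reflection≉ε ref r≈ε = reflection-odd ref (σ-cong r≈ε)

  rotation-even : ∀ {x} → IsRotation x → σ x ≡ false
  rotation-even (r , s , (_ , σr) , (_ , σs) , x≈rs) =
    ≡.trans (σ-cong x≈rs) (≡.trans (σ-∙ r s) (≡.cong₂ _xor_ σr σs))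

  reflection≢rotation : ∀ {x y} → IsReflection x → IsRotation y → σ x ≢ σ y
  reflection≢rotation (_ , σx) rot σx≡σy with ≡.trans (≡.sym σx) (≡.trans σx≡σy (rotation-even rot))
  ... | ()

  -- Satisfied by every dihedral group, with σ the orientation character.
  module _ (reflection-or-rotation : ∀ x → IsReflection x ⊎ IsRotation x) where

    some-reflection : ∃ IsReflection
    some-reflection with reflection-or-rotation ε
    ... | inj₁ ref = ⊥-elim (reflection-odd ref ≡.refl)
    ... | inj₂ (r , _ , ref , _) = r , ref

    reflectionPair : ∀ {r t} → IsReflection r → IsReflection t → Group.Carrier fibreProduct
    reflectionPair {r} {t} (_ , σr) (_ , σt) = (r , t) , ≡.trans σr (≡.sym σt)

    fibreProduct-generated : GeneratedBy fibreProduct (SquaresToOne fibreProduct)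
    fibreProduct-generated ((x , y) , s) with reflection-or-rotation x | reflection-or-rotation y
    ... | inj₁ (x²≈ε , _) | inj₁ (y²≈ε , _) = gen (lift (x²≈ε , y²≈ε))
    ... | inj₁ ref        | inj₂ rot        = ⊥-elim (reflection≢rotation ref rot s)
    ... | inj₂ rot        | inj₁ ref        = ⊥-elim (reflection≢rotation ref rot (≡.sym s))
    ... | inj₂ (r , r′ , ref-r , ref-r′ , x≈rr′) | inj₂ (t , t′ , ref-t , ref-t′ , y≈tt′) =
      resp (≈-sym x≈rr′ , ≈-sym y≈tt′) (mul (pair ref-r ref-t) (pair ref-r′ ref-t′))
      where
      pair : ∀ {r t} (ref-r : IsReflection r) (ref-t : IsReflection t) →
             ⟨ fibreProduct ⟩ (SquaresToOne fibreProduct) (reflectionPair ref-r ref-t)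
      pair (r²≈ε , _) (t²≈ε , _) = gen (lift (r²≈ε , t²≈ε))

    ×-isGIExtension : IsGIExtension fibreProduct (K ×ᴳ K)
    ×-isGIExtension = proj₁ , proj₁-isMonomorphism , normal , index2 , generated
      where
      open Group fibreProduct using () renaming (_∙_ to _∙ᶠ_; _⁻¹ to _⁻¹ᶠ)

      N : Carrier × Carrier → Set (c ⊔ ℓ)
      N y = ∃ λ e → Pointwise _≈_ _≈_ (proj₁ e) y

      N⇒sameSign : ∀ {x y} → N (x , y) → σ x ≡ σ y
      N⇒sameSign ((_ , s) , x′≈x , y′≈y) = ≡.trans (≡.sym (σ-cong x′≈x)) (≡.trans s (σ-cong y′≈y))

      normal : IsNormalSubgroup (K ×ᴳ K) N
      normal =
        (λ (x≈x′ , y≈y′) (e , a , b) → e , ≈-trans a x≈x′ , ≈-trans b y≈y′) ,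
        (Group.ε fibreProduct , ≈-refl , ≈-refl) ,
        (λ (e , a , b) (e′ , a′ , b′) → e ∙ᶠ e′ , ∙-cong a a′ , ∙-cong b b′) ,
        (λ (e , a , b) → e ⁻¹ᶠ , ⁻¹-cong a , ⁻¹-cong b) ,
        λ (g , h) (((x , y) , s) , a , b) →
          (((g ∙ x) ∙ g ⁻¹ , (h ∙ y) ∙ h ⁻¹) ,
           ≡.trans (σ-conjugate g x) (≡.trans s (≡.sym (σ-conjugate h y)))) ,
          ∙-congʳ (∙-congˡ a) , ∙-congʳ (∙-congˡ b)

      index2 : HasIndex2 (K ×ᴳ K) N
      index2 with some-reflection
      ... | r , ref@(_ , σr) = (r , ε) , (λ n → reflection-odd ref (N⇒sameSign n)) , λ (x , y) → coset x y
        where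
        coset : ∀ x y → N (x , y) ⊎ N (r ⁻¹ ∙ x , ε ⁻¹ ∙ y)
        coset x y with σ x ≟ᵇ σ y
        ... | yes s = inj₁ (((x , y) , s) , ≈-refl , ≈-refl)
        ... | no ¬s = inj₂ (((r ⁻¹ ∙ x , ε ⁻¹ ∙ y) , sameSign) , ≈-refl , ≈-refl)
          where
          sameSign : σ (r ⁻¹ ∙ x) ≡ σ (ε ⁻¹ ∙ y)
          sameSign = begin
            σ (r ⁻¹ ∙ x)        ≡⟨ σ-∙ (r ⁻¹) x ⟩
            σ (r ⁻¹) xor σ x    ≡⟨ ≡.cong (_xor σ x) (≡.trans (σ-⁻¹ r) σr) ⟩
            not (σ x)           ≡⟨ ¬-not (λ s → ¬s (≡.sym s)) ⟨
            σ y                 ≡⟨ ≡.cong (_xor σ y) (≡.trans (σ-⁻¹ ε) σ-ε) ⟨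
            σ (ε ⁻¹) xor σ y    ≡⟨ σ-∙ (ε ⁻¹) y ⟨
            σ (ε ⁻¹ ∙ y)        ∎
            where open ≡.≡-Reasoning

      Generator : Carrier × Carrier → Set (c ⊔ ℓ)
      Generator p = IsInvolution (K ×ᴳ K) p × ¬ N p

      reflectionˡ : ∀ {r} → IsReflection r → Generator (r , ε)
      reflectionˡ ref@(r²≈ε , _) =
        ((r²≈ε , identityˡ ε) , λ (r≈ε , _) → reflection≉ε ref r≈ε) ,
        λ n → reflection-odd ref (N⇒sameSign n)

      reflectionʳ : ∀ {r} → IsReflection r → Generator (ε , r)
      reflectionʳ ref@(r²≈ε , _) =
        ((identityˡ ε , r²≈ε) , λ (_ , r≈ε) → reflection≉ε ref r≈ε) ,
        λ n → reflection-odd ref (≡.sym (N⇒sameSign n))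

      leftFactor : ∀ x → ⟨ K ×ᴳ K ⟩ Generator (x , ε)
      leftFactor x with reflection-or-rotation x
      ... | inj₁ ref = gen (reflectionˡ ref)
      ... | inj₂ (_ , _ , ref , ref′ , x≈rr′) =
        resp (≈-sym x≈rr′ , identityˡ ε) (mul (gen (reflectionˡ ref)) (gen (reflectionˡ ref′)))

      rightFactor : ∀ y → ⟨ K ×ᴳ K ⟩ Generator (ε , y)
      rightFactor y with reflection-or-rotation y
      ... | inj₁ ref = gen (reflectionʳ ref)
      ... | inj₂ (_ , _ , ref , ref′ , y≈rr′) =
        resp (identityˡ ε , ≈-sym y≈rr′) (mul (gen (reflectionʳ ref)) (gen (reflectionʳ ref′)))

      generated : GeneratedBy (K ×ᴳ K) Generator
      generated (x , y) = resp (identityʳ x , identityˡ y) (mul (leftFactor x) (rightFactor y))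

-- ρ is a rotation of order 3 and τₖ = ρᵏ τ₀ are the three reflections.
S₃ : Set
S₃ = Fin 6

pattern e  = zero
pattern ρ  = suc zero
pattern ρ² = suc (suc zero)
pattern τ₀ = suc (suc (suc zero))
pattern τ₁ = suc (suc (suc (suc zero)))
pattern τ₂ = suc (suc (suc (suc (suc zero))))

infixl 7 _·_
_·_ : S₃ → S₃ → S₃
e  · y  = y
x  · e  = x
ρ  · ρ  = ρ²
ρ  · ρ² = e
ρ  · τ₀ = τ₁
ρ  · τ₁ = τ₂
ρ  · τ₂ = τ₀
ρ² · ρ  = e
ρ² · ρ² = ρ
ρ² · τ₀ = τ₂
ρ² · τ₁ = τ₀
ρ² · τ₂ = τ₁
τ₀ · ρ  = τ₂
τ₀ · ρ² = τ₁
τ₀ · τ₀ = e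
τ₀ · τ₁ = ρ²
τ₀ · τ₂ = ρ
τ₁ · ρ  = τ₀
τ₁ · ρ² = τ₂
τ₁ · τ₀ = ρ
τ₁ · τ₁ = e
τ₁ · τ₂ = ρ²
τ₂ · ρ  = τ₁
τ₂ · ρ² = τ₀
τ₂ · τ₀ = ρ²
τ₂ · τ₁ = ρ
τ₂ · τ₂ = e

_⁻¹ : S₃ → S₃
ρ  ⁻¹ = ρ²
ρ² ⁻¹ = ρ
x  ⁻¹ = x

sign : S₃ → Bool
sign e  = false
sign ρ  = false
sign ρ² = false
sign τ₀ = true
sign τ₁ = true
sign τ₂ = true

S₃-group : Group 0ℓ 0ℓ
S₃-group = record
  { Carrier = S₃
  ; _≈_     = _≡_
  ; _∙_     = _·_
  ; ε       = e
  ; _⁻¹     = _⁻¹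
  ; isGroup = record
    { isMonoid = record
      { isSemigroup = record
        { isMagma = record { isEquivalence = ≡.isEquivalence ; ∙-cong = ≡.cong₂ _·_ }
        ; assoc   = from-yes (all? λ x → all? λ y → all? λ z → (x · y) · z ≟ x · (y · z)) }
      ; identity = from-yes (all? λ x → e · x ≟ x) , from-yes (all? λ x → x · e ≟ x) }
    ; inverse = from-yes (all? λ x → x ⁻¹ · x ≟ e) , from-yes (all? λ x → x · x ⁻¹ ≟ e)
    ; ⁻¹-cong = ≡.cong _⁻¹
    }
  }

sign-isHomomorphism : IsGroupHomomorphism (Group.rawGroup S₃-group) (Group.rawGroup C₂) sign
sign-isHomomorphism = record
  { isMonoidHomomorphism = record
    { isMagmaHomomorphism = record
      { isRelHomomorphism = record { cong = ≡.cong sign }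
      ; homo = from-yes (all? λ x → all? λ y → sign (x · y) ≟ᵇ sign x xor sign y) }
    ; ε-homo = ≡.refl }
  ; ⁻¹-homo = from-yes (all? λ x → sign (x ⁻¹) ≟ᵇ sign x) }

S₃-trivialCentre : HasTrivialCentre S₃-group
S₃-trivialCentre = from-yes (all? λ z → (all? λ y → z · y ≟ y · z) →-dec z ≟ e)

open FibreProduct S₃-group sign-isHomomorphism

S₃-reflection-or-rotation : ∀ x → IsReflection x ⊎ IsRotation x
S₃-reflection-or-rotation =
  from-yes (all? λ x → reflection? x ⊎-dec any? λ r → any? λ s →
    reflection? r ×-dec reflection? s ×-dec x ≟ r · s)
  where
  reflection? : ∀ x → Dec (IsReflection x)
  reflection? x = x · x ≟ e ×-dec sign x ≟ᵇ true

mainTheorem3 : Σ (Group 0ℓ 0ℓ) λ G → Σ (Group 0ℓ 0ℓ) λ G₁' → Σ (Group 0ℓ 0ℓ) λ G₂' →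
    IsGIExtension G G₁' × IsGIExtension G G₂' × ¬ (G₁' ≅ G₂')
mainTheorem3 =
  fibreProduct , fibreProduct ×ᴳ C₂ , S₃-group ×ᴳ S₃-group ,
  ×C₂-isGIExtension fibreProduct (fibreProduct-generated S₃-reflection-or-rotation) ,
  ×-isGIExtension S₃-reflection-or-rotation ,
  ×C₂≇centreless fibreProduct (S₃-group ×ᴳ S₃-group)
    (×-trivialCentre S₃-group S₃-group S₃-trivialCentre S₃-trivialCentre)
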